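{- Let $\tau$ be a correct translation from SYNCSIMPLE $\to$ LOCKSIMPLE$_{k,IS}$ for $k \geq 1$. Then there is a reduction sequence of $\tau(!) \mid \tau(?)$ that executes every symbol in $\tau(!) \mid \tau(?)$.
   Context: SYNCSIMPLE: subprocesses $U ::= \checkmark \mid 0 \mid\ !U \mid\ ?U$; processes are parallel compositions (multisets) of subprocesses; reduction $!U_1 \mid ?U_2 \mid P \to U_1 \mid U_2 \mid P$; successful = has a parallel component $\checkmark$; may-convergent = reduces to a successful process; must-convergent = every reduct is may-convergent. LOCKSIMPLE$_{k,IS}$: $k$ locks, each full ($\blacksquare$) or empty ($\Box$), initial store $IS$; subprocesses $U ::= 0 \mid \checkmark \mid P_iU \mid T_iU$; $P_i$ on empty lock $i$ fills it, on a full lock blocks; $T_i$ never blocks and empties lock $i$. Reductions start from the store $IS$. $\tau$ is compositional ($\tau(0)=0$, $\tau(\checkmark)=\checkmark$, $\tau$ commutes with parallel composition, $\tau(!U)=\tau(!)\tau(U)$, $\tau(?U)=\tau(?)\tau(U)$, with $\tau(!),\tau(?)$ strings of $P_i,T_i$); correct = preserve and reflect may- and must-convergence. -}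

module Defs where

open import Data.Nat using (ℕ)
open import Data.Fin using (Fin)
open import Data.Bool using (Bool; true; false)
open import Data.Vec using (Vec; lookup; _[_]≔_)
open import Data.List using (List; []; _∷_; map; foldr)
open import Data.List.Membership.Propositional using (_∈_)
open import Data.List.Relation.Binary.Permutation.Propositional using (_↭_)
open import Data.Product using (Σ; ∃; _×_; _,_)
open import Function.Bundles using (_⇔_)
open import Relation.Binary.PropositionalEquality using (_≡_)
open import Relation.Binary.Construct.Closure.ReflexiveTransitive using (Star)

data SU : Set where
  ✓  : SU
  𝟘  : SU
  !_ : SU → SU
  ¿_ : SU → SU      -- the input prefix "?U"

-- processes: parallel compositions, i.e. multisets, represented by lists
-- (all notions below are invariant under permutation)
SProc : Set
SProc = List SU

data _⟶S_ : SProc → SProc → Set where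
  sync : ∀ {P} U₁ U₂ R → P ↭ ((! U₁) ∷ (¿ U₂) ∷ R) → P ⟶S (U₁ ∷ U₂ ∷ R)

_⟶S*_ : SProc → SProc → Set
_⟶S*_ = Star _⟶S_

SSuccessful : SProc → Set
SSuccessful P = ✓ ∈ P

SMay : SProc → Set
SMay P = ∃ λ Q → P ⟶S* Q × SSuccessful Q

SMust : SProc → Set
SMust P = ∀ Q → P ⟶S* Q → SMay Q

-- lock contents: true = full (■), false = empty (□)
Store : ℕ → Set
Store k = Vec Bool k

data Sym (k : ℕ) : Set where
  Pᵢ : Fin k → Sym k
  Tᵢ : Fin k → Sym k

data LU (k : ℕ) : Set where
  𝟘  : LU k
  ✓  : LU k
  _∙_ : Sym k → LU k → LU k

LProc : ℕ → Set
LProc k = List (LU k)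

Config : ℕ → Set
Config k = Store k × LProc k

data _⟶L_ {k : ℕ} : Config k → Config k → Set where
  put  : ∀ {s P} i U R → P ↭ ((Pᵢ i ∙ U) ∷ R) → lookup s i ≡ false →
         (s , P) ⟶L ((s [ i ]≔ true) , (U ∷ R))
  take : ∀ {s P} i U R → P ↭ ((Tᵢ i ∙ U) ∷ R) →
         (s , P) ⟶L ((s [ i ]≔ false) , (U ∷ R))

_⟶L*_ : ∀ {k} → Config k → Config k → Set
_⟶L*_ = Star _⟶L_

LSuccessful : ∀ {k} → Config k → Set
LSuccessful (s , P) = ✓ ∈ P

LMayC : ∀ {k} → Config k → Set
LMayC C = ∃ λ C′ → C ⟶L* C′ × LSuccessful C′

LMustC : ∀ {k} → Config k → Set
LMustC C = ∀ C′ → C ⟶L* C′ → LMayC C′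

LMay : ∀ {k} → Store k → LProc k → Set
LMay IS P = LMayC (IS , P)

LMust : ∀ {k} → Store k → LProc k → Set
LMust IS P = LMustC (IS , P)

-- a compositional translation is determined by the strings τ(!) and τ(?)
record Translation (k : ℕ) : Set where
  field
    τ! : List (Sym k)
    τ? : List (Sym k)

prefix : ∀ {k} → List (Sym k) → LU k → LU k
prefix w U = foldr _∙_ U w

module _ {k : ℕ} (τ : Translation k) where
  open Translation τ

  τU : SU → LU k
  τU ✓ = ✓
  τU 𝟘 = 𝟘
  τU (! U) = prefix τ! (τU U)
  τU (¿ U) = prefix τ? (τU U)

  τP : SProc → LProc k
  τP = map τU

Correct : ∀ {k} → Store k → Translation k → Set
Correct IS τ = ∀ (P : SProc) →
  (SMay P ⇔ LMay IS (τP τ P)) × (SMust P ⇔ LMust IS (τP τ P))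

-- "a reduction sequence of τ(!) | τ(?) that executes every symbol":
-- starting from store IS, the process τ(!)0 | τ(?)0 reduces to 0 | 0
ExecutesAll : ∀ {k} → Store k → Translation k → Set
ExecutesAll {k} IS τ =
  ∃ λ (s : Store k) →
    (IS , (prefix (Translation.τ! τ) 𝟘 ∷ prefix (Translation.τ? τ) 𝟘 ∷ []))
      ⟶L* (s , (𝟘 ∷ 𝟘 ∷ []))

-- Since !0 | ?✓ may converge, some reduction of τ(!)0 | τ(?)✓ from IS exposes the ✓, i.e.
-- executes all of τ(?) together with some prefix of τ(!), leaving a store s and a suffix u.
-- Lock reductions do not look at the continuations 0 and ✓, so the same run takes
-- τ(!)✓ | τ(?)0 to u✓ | 0 with store s. As !✓ | ?0 must converge, u✓ | 0 may converge
-- from s, which forces u to be executed completely. Concatenating both runs, now over the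
-- continuations 0 | 0, executes every symbol of τ(!) | τ(?).
module Submission where

open import Defs
open import Data.Nat using (ℕ; _≥_)
open import Data.Bool using (true; false)
open import Data.Vec using (lookup; _[_]≔_)
open import Data.List using (List; []; _∷_; [_])
open import Data.List.Membership.Propositional using (_∈_)
open import Data.List.Relation.Unary.Any using (here; there)
open import Data.List.Relation.Binary.Permutation.Propositional
open import Data.List.Relation.Binary.Permutation.Propositional.Properties
  using (↭-singleton-inv; ∈-resp-↭; ↭-length; drop-∷)
open import Data.Product using (∃; ∃₂; _×_; _,_; proj₁; proj₂)
open import Data.Sum using (_⊎_; inj₁; inj₂)
open import Function.Bundles using (Equivalence)
open import Relation.Binary.PropositionalEquality using (_≡_; refl; sym)
open import Relation.Binary.Construct.Closure.ReflexiveTransitive using (Star; ε; _◅_; _◅◅_)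

module _ {A : Set} where

  ↭-pair-inv : ∀ {x a b : A} {R} → x ∷ R ↭ a ∷ b ∷ [] →
               (x ≡ a × R ≡ [ b ]) ⊎ (x ≡ b × R ≡ [ a ])
  ↭-pair-inv {R = R} ρ with ∈-resp-↭ ρ (here {xs = R} refl)
  ... | here refl         = inj₁ (refl , ↭-singleton-inv (drop-∷ ρ))
  ... | there (here refl) = inj₂ (refl , ↭-singleton-inv (drop-∷ (↭-trans ρ (swap _ _ refl))))

  ↭-doubleton-inv : ∀ {a : A} {P} → P ↭ a ∷ a ∷ [] → P ≡ a ∷ a ∷ []
  ↭-doubleton-inv {P = []} ρ with () ← ↭-length ρ
  ↭-doubleton-inv {P = _ ∷ _} ρ with ↭-pair-inv ρ
  ... | inj₁ (refl , refl) = refl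
  ... | inj₂ (refl , refl) = refl

⟶S-keeps-✓ : ∀ {Q Q′} → Q ⟶S Q′ → ✓ ∈ Q → ✓ ∈ Q′
⟶S-keeps-✓ (sync U₁ U₂ R ρ) m with ∈-resp-↭ ρ m
... | here ()
... | there (here ())
... | there (there m′) = there (there m′)

⟶S*-keeps-✓ : ∀ {Q Q′} → Q ⟶S* Q′ → ✓ ∈ Q → ✓ ∈ Q′
⟶S*-keeps-✓ ε m = m
⟶S*-keeps-✓ (step ◅ steps) m = ⟶S*-keeps-✓ steps (⟶S-keeps-✓ step m)

!𝟘∣¿✓ : SProc
!𝟘∣¿✓ = (! 𝟘) ∷ (¿ ✓) ∷ []

!✓∣¿𝟘 : SProc
!✓∣¿𝟘 = (! ✓) ∷ (¿ 𝟘) ∷ []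

!𝟘∣¿✓-may : SMay !𝟘∣¿✓
!𝟘∣¿✓-may = _ , sync 𝟘 ✓ [] refl ◅ ε , there (here refl)

!✓∣¿𝟘-step : ∀ {Q} → !✓∣¿𝟘 ⟶S Q → ✓ ∈ Q
!✓∣¿𝟘-step (sync U₁ U₂ R ρ) with ∈-resp-↭ (↭-sym ρ) (here {xs = ¿ U₂ ∷ R} refl)
... | here refl = here refl
... | there (here ())
... | there (there ())

!✓∣¿𝟘-must : SMust !✓∣¿𝟘
!✓∣¿𝟘-must _ ε              = _ , sync ✓ 𝟘 [] refl ◅ ε , here refl
!✓∣¿𝟘-must _ (step ◅ steps) = _ , ε , ⟶S*-keeps-✓ steps (!✓∣¿𝟘-step step)

module _ {k : ℕ} where

  data Exec : Store k → Sym k → Store k → Set where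
    put  : ∀ {s} i → lookup s i ≡ false → Exec s (Pᵢ i) (s [ i ]≔ true)
    take : ∀ {s} i → Exec s (Tᵢ i) (s [ i ]≔ false)

  exec⇒⟶L : ∀ {s a s′ U R P} → Exec s a s′ → P ↭ (a ∙ U) ∷ R → (s , P) ⟶L (s′ , U ∷ R)
  exec⇒⟶L (put i free) ρ = put i _ _ ρ free
  exec⇒⟶L (take i)     ρ = take i _ _ ρ

  -- The store together with the not yet executed parts of the two prefix strings.
  Stacks : Set
  Stacks = Store k × List (Sym k) × List (Sym k)

  data _⟶E_ : Stacks → Stacks → Set where
    left  : ∀ {s a s′ u v} → Exec s a s′ → (s , a ∷ u , v) ⟶E (s′ , u , v)
    right : ∀ {s a s′ u v} → Exec s a s′ → (s , u , a ∷ v) ⟶E (s′ , u , v)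

  _⟶E*_ : Stacks → Stacks → Set
  _⟶E*_ = Star _⟶E_

  ⟶E*-[]ʳ : ∀ {s u s′ u′ v′} → (s , u , []) ⟶E* (s′ , u′ , v′) → v′ ≡ []
  ⟶E*-[]ʳ ε            = refl
  ⟶E*-[]ʳ (left _ ◅ r) = ⟶E*-[]ʳ r

  pair : List (Sym k) → LU k → List (Sym k) → LU k → LProc k
  pair u X v Y = prefix u X ∷ prefix v Y ∷ []

  data Terminal : LU k → Set where
    ✓ : Terminal ✓
    𝟘 : Terminal 𝟘

  prefix-∙-inv : ∀ {X a U} → Terminal X → ∀ w → prefix w X ≡ a ∙ U →
                 ∃ λ w′ → w ≡ a ∷ w′ × U ≡ prefix w′ X
  prefix-∙-inv ✓ [] ()
  prefix-∙-inv 𝟘 [] ()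
  prefix-∙-inv _ (a ∷ w) refl = w , refl , refl

  module _ {X Y : LU k} (tX : Terminal X) (tY : Terminal Y) where

    exec-reflect : ∀ {s a s′ U R P u v} → Exec s a s′ → P ↭ (a ∙ U) ∷ R → P ↭ pair u X v Y →
      ∃₂ λ u′ v′ → (s , u , v) ⟶E (s′ , u′ , v′) × U ∷ R ↭ pair u′ X v′ Y
    exec-reflect {u = u} {v} e ρ σ with ↭-pair-inv (↭-trans (↭-sym ρ) σ)
    ... | inj₁ (eq , refl) with prefix-∙-inv tX u (sym eq)
    ...   | u′ , refl , refl = u′ , v , left e , ↭-refl
    exec-reflect {u = u} {v} e ρ σ | inj₂ (eq , refl) with prefix-∙-inv tY v (sym eq)
    ...   | v′ , refl , refl = u , v′ , right e , swap _ _ refl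

    ⟶L-reflect : ∀ {s P C′ u v} → (s , P) ⟶L C′ → P ↭ pair u X v Y →
      ∃₂ λ u′ v′ → (s , u , v) ⟶E (proj₁ C′ , u′ , v′) × proj₂ C′ ↭ pair u′ X v′ Y
    ⟶L-reflect (put i U R ρ free) = exec-reflect (put i free) ρ
    ⟶L-reflect (take i U R ρ)     = exec-reflect (take i) ρ

    ⟶L*-reflect : ∀ {C C′ u v} → C ⟶L* C′ → proj₂ C ↭ pair u X v Y →
      ∃₂ λ u′ v′ → (proj₁ C , u , v) ⟶E* (proj₁ C′ , u′ , v′) × proj₂ C′ ↭ pair u′ X v′ Y
    ⟶L*-reflect ε σ = _ , _ , ε , σ
    ⟶L*-reflect (step ◅ steps) σ with ⟶L-reflect step σ
    ... | _ , _ , e , σ₁ with ⟶L*-reflect steps σ₁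
    ...   | u′ , v′ , es , σ′ = u′ , v′ , e ◅ es , σ′

  module _ (X Y : LU k) where

    ⟶E-lift : ∀ {s u v s′ u′ v′ P} → (s , u , v) ⟶E (s′ , u′ , v′) → P ↭ pair u X v Y →
      ∃ λ P′ → (s , P) ⟶L (s′ , P′) × P′ ↭ pair u′ X v′ Y
    ⟶E-lift (left e)  σ = _ , exec⇒⟶L e σ , ↭-refl
    ⟶E-lift (right e) σ = _ , exec⇒⟶L e (↭-trans σ (swap _ _ refl)) , swap _ _ refl

    ⟶E*-lift : ∀ {s u v s′ u′ v′ P} → (s , u , v) ⟶E* (s′ , u′ , v′) → P ↭ pair u X v Y →
      ∃ λ P′ → (s , P) ⟶L* (s′ , P′) × P′ ↭ pair u′ X v′ Y
    ⟶E*-lift ε σ = _ , ε , σ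
    ⟶E*-lift (e ◅ es) σ with ⟶E-lift e σ
    ... | _ , step , σ₁ with ⟶E*-lift es σ₁
    ...   | P′ , steps , σ′ = P′ , step ◅ steps , σ′

  Exposes✓ : List (Sym k) → LU k → List (Sym k) → LU k → Set
  Exposes✓ u X v Y = (u ≡ [] × X ≡ ✓) ⊎ (v ≡ [] × Y ≡ ✓)

  ✓∈pair : ∀ {u X v Y} → ✓ ∈ pair u X v Y → Exposes✓ u X v Y
  ✓∈pair {[]}    (here refl)         = inj₁ (refl , refl)
  ✓∈pair {_ ∷ _} (here ())
  ✓∈pair {v = []}    (there (here refl)) = inj₂ (refl , refl)
  ✓∈pair {v = _ ∷ _} (there (here ()))
  ✓∈pair (there (there ()))

  LMayC-pair⇒⟶E* : ∀ {X Y s P u v} → Terminal X → Terminal Y → LMayC (s , P) →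
    P ↭ pair u X v Y →
    ∃ λ s′ → ∃₂ λ u′ v′ → (s , u , v) ⟶E* (s′ , u′ , v′) × Exposes✓ u′ X v′ Y
  LMayC-pair⇒⟶E* tX tY (_ , steps , success) σ with ⟶L*-reflect tX tY steps σ
  ... | u′ , v′ , run , σ′ = _ , u′ , v′ , run , ✓∈pair (∈-resp-↭ σ′ success)

lemma4p1 : (k : ℕ) → k ≥ 1 → (IS : Store k) → (τ : Translation k) →
    Correct IS τ → ExecutesAll IS τ
lemma4p1 k _ IS τ correct
  with LMayC-pair⇒⟶E* {u = Translation.τ! τ} {v = Translation.τ? τ} 𝟘 ✓
         (Equivalence.to (proj₁ (correct !𝟘∣¿✓)) !𝟘∣¿✓-may) ↭-refl
... | _ , _ , _ , _ , inj₁ (_ , ())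
... | _ , _ , _ , run₁ , inj₂ (refl , _)
  with ⟶E*-lift ✓ 𝟘 run₁ ↭-refl
... | _ , steps₁ , σ₁
  with LMayC-pair⇒⟶E* ✓ 𝟘 (Equivalence.to (proj₂ (correct !✓∣¿𝟘)) !✓∣¿𝟘-must _ steps₁) σ₁
... | _ , _ , _ , _ , inj₂ (_ , ())
... | s₂ , _ , _ , run₂ , inj₁ (refl , _)
  with refl ← ⟶E*-[]ʳ run₂
  with ⟶E*-lift 𝟘 𝟘 (run₁ ◅◅ run₂) ↭-refl
... | _ , steps , σ
  with refl ← ↭-doubleton-inv σ = s₂ , steps
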